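{- Let $M=\langle W,\succeq,\mathbb{V}\rangle$ be a smooth preference model with $\succeq$ transitive, $\varphi$ a formula, $rep$ a choice function on nonempty subsets of $W$, and $v\in W$. Then the block $\mathrm{chain}(\mathrm{MaxSeq}(\mathrm{Bet}(v),\mathrm{Cond}(\varphi)))$ (iv)-covers the block $\mathrm{antichain}(\{v\})$.
   Context: Formulas: $x\in\mathit{Var}\mid\neg\psi\mid\psi_1\wedge\psi_2\mid\Box\psi\mid\mathcal{O}(\psi_1\mid\psi_2)$; $\mathrm{Cond}(\varphi)=\{\alpha:\mathcal{O}(\gamma\mid\alpha)\text{ a subformula of }\varphi\}$. A preference model $M=\langle W,\succeq,\mathbb{V}\rangle$: $W$ nonempty, $\succeq$ binary relation; $w_1\succ w_2$ iff $w_1\succeq w_2$ and not $w_2\succeq w_1$; $\max_\succ(U)=\{v\in U:\neg\exists u\in U,u\succ v\}$; $\mathrm{Bet}(v)=\{w:w\succ v\}$. Truth sets: $\|x\|=\mathbb{V}(x)$, $\|\neg\psi\|=W\setminus\|\psi\|$, $\|\psi_1\wedge\psi_2\|=\|\psi_1\|\cap\|\psi_2\|$, $\|\Box\beta\|=W$ if $\|\beta\|=W$ else $\emptyset$, $\|\mathcal{O}(\gamma\mid\alpha)\|=W$ if $\max_\succ(\|\alpha\|)\subseteq\|\gamma\|$ else $\emptyset$; $M,w\models\psi$ iff $w\in\|\psi\|$. $M$ is smooth if for every formula $\alpha$ and $w\in\|\alpha\|$ there is $u\in\max_\succ(\|\alpha\|)$ with $u=w$ or $u\succ w$. $\mathrm{SatForm}(M,U)=\{\psi:\exists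 u\in U,M,u\models\psi\}$. $rep$ assigns to each nonempty $S\subseteq W$ an element of $S$. For $U\subseteq W$ and finite $\mathcal{A}$, $D(U,\mathcal{A})=U\cap\max_\succ(\|\bigvee_{\alpha\in\mathcal{A}}\alpha\|)$; $\mathrm{MaxSeq}(U,\mathcal{A})$ is empty if $\mathcal{A}=\emptyset$ or $D(U,\mathcal{A})=\emptyset$, and otherwise the list starting with $z=rep(D(U,\mathcal{A}))$ followed by $\mathrm{MaxSeq}(U,\{\alpha\in\mathcal{A}:M,z\not\models\alpha\})$. Blocks: pairs $\langle U,\succeq_U\rangle$, $U\subseteq W$, $W(\langle U,\succeq_U\rangle)=U$; $\mathrm{antichain}(U)=\langle U,\emptyset\rangle$; $\mathrm{chain}([w_1,\dots,w_n])=\langle\{w_1,\dots,w_n\},\succeq^{ch}\rangle$ with $w_i\succeq^{ch}w_j$ iff $i\le j$. $B'$ (iv)-covers $B$ if $\mathrm{SatForm}(M,\mathrm{Bet}(w))\cap\mathrm{Cond}(\varphi)\subseteq\mathrm{SatForm}(M,W(B'))$ for every $w\in W(B)$. -}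

module Defs where

open import Data.Nat using (ℕ; zero; suc; _≤_)
open import Data.Fin using (Fin; toℕ)
open import Data.List using (List; []; _∷_; _++_; length; filter; lookup)
open import Data.List.Membership.Propositional using (_∈_)
open import Data.Product using (Σ; ∃; _×_; _,_)
open import Data.Sum using (_⊎_)
open import Data.Empty using (⊥)
open import Relation.Nullary using (¬_; Dec; yes; no; ¬?)
open import Relation.Binary.PropositionalEquality using (_≡_)
open import Axiom.ExcludedMiddle using (ExcludedMiddle)
open import Level using (0ℓ)

data Form (Var : Set) : Set where
  var  : Var → Form Var
  neg  : Form Var → Form Var
  and  : Form Var → Form Var → Form Var
  box  : Form Var → Form Var
  obl  : Form Var → Form Var → Form Var   -- obl γ α  is  O(γ | α)

cond : {Var : Set} → Form Var → List (Form Var)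
cond (var x)   = []
cond (neg ψ)   = cond ψ
cond (and ψ χ) = cond ψ ++ cond χ
cond (box ψ)   = cond ψ
cond (obl γ α) = α ∷ (cond γ ++ cond α)

record PrefModel (Var : Set) : Set₁ where
  field
    W   : Set
    _⪰_ : W → W → Set
    V   : Var → W → Set

module _ {Var : Set} (M : PrefModel Var) where
  open PrefModel M

  _≻_ : W → W → Set
  a ≻ b = (a ⪰ b) × ¬ (b ⪰ a)

  Max : (W → Set) → W → Set
  Max U v = U v × ¬ (∃ λ u → U u × (u ≻ v))

  Bet : W → W → Set
  Bet v w = w ≻ v

  _⊨_ : W → Form Var → Set
  w ⊨ var x   = V x w
  w ⊨ neg ψ   = ¬ (w ⊨ ψ)
  w ⊨ and ψ χ = (w ⊨ ψ) × (w ⊨ χ)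
  w ⊨ box β   = ∀ u → u ⊨ β
  w ⊨ obl γ α = ∀ u → Max (λ x → x ⊨ α) u → u ⊨ γ

  Transitive : Set
  Transitive = ∀ a b c → a ⪰ b → b ⪰ c → a ⪰ c

  Smooth : Set
  Smooth = ∀ (α : Form Var) (w : W) → w ⊨ α →
           ∃ λ u → Max (λ x → x ⊨ α) u × ((u ≡ w) ⊎ (u ≻ w))

  SatForm : (W → Set) → Form Var → Set
  SatForm U ψ = ∃ λ u → U u × (u ⊨ ψ)

  BigOr : List (Form Var) → W → Set
  BigOr A w = ∃ λ α → (α ∈ A) × (w ⊨ α)

  D : (W → Set) → List (Form Var) → W → Set
  D U A w = U w × Max (BigOr A) w

  -- a choice function on nonempty subsets of W
  -- (its value on the empty subset is irrelevant)
  record Rep : Set₁ where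
    field
      rep     : (W → Set) → W
      rep-mem : ∀ (S : W → Set) → (∃ λ w → S w) → S (rep S)

  record Block : Set₁ where
    field
      carrier : W → Set
      rel     : W → W → Set

  antichain : (W → Set) → Block
  antichain U = record { carrier = U ; rel = λ _ _ → ⊥ }

  chain : List W → Block
  chain L = record
    { carrier = λ w → w ∈ L
    ; rel = λ a b → Σ (Fin (length L)) λ i → Σ (Fin (length L)) λ j →
              (toℕ i ≤ toℕ j) × (lookup L i ≡ a) × (lookup L j ≡ b) }

  IVCovers : Form Var → Block → Block → Set
  IVCovers φ B' B = ∀ w → Block.carrier B w → ∀ α → α ∈ cond φ →
                    SatForm (Bet w) α → SatForm (Block.carrier B') α

  -- MaxSeq(U, A); the paper's definition is classical (it tests D(U,A) = ∅
  -- and M,z ⊭ α), so we use an excluded-middle oracle to decide these.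
  -- The recursion is bounded by fuel; fuel = length A always suffices,
  -- since each step removes at least one formula (z ∈ D satisfies some α ∈ A).
  module _ (lem : ExcludedMiddle 0ℓ) (r : Rep) where
    open Rep r

    maxSeqF : ℕ → (W → Set) → List (Form Var) → List W
    maxSeqF zero    U A       = []
    maxSeqF (suc n) U []      = []
    maxSeqF (suc n) U (a ∷ A) with lem {∃ λ w → D U (a ∷ A) w}
    ... | no _  = []
    ... | yes _ = z ∷ maxSeqF n U (filter (λ α → ¬? (lem {z ⊨ α})) (a ∷ A))
      where z = rep (D U (a ∷ A))

    MaxSeq : (W → Set) → List (Form Var) → List W
    MaxSeq U A = maxSeqF (length A) U A

{-# OPTIONS --safe #-}
module Submission where

open import Defs
open import Axiom.ExcludedMiddle using (ExcludedMiddle)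
open import Level using (0ℓ)
open import Relation.Binary.PropositionalEquality using (_≡_; refl)
open import Data.Nat using (zero; suc; _≤_; _<_; s≤s)
open import Data.Nat.Properties using (≤-refl; ≤-trans; ≤-pred)
open import Data.List using (List; []; _∷_; filter; length)
open import Data.List.Properties using (filter-notAll)
open import Data.List.Membership.Propositional using (_∈_)
open import Data.List.Membership.Propositional.Properties using (∈-filter⁺)
open import Data.List.Relation.Unary.Any using (here; there)
import Data.List.Relation.Unary.Any as Any
open import Data.Product using (∃; _×_; _,_; proj₁; proj₂; map₁; map₂)
open import Data.Sum using (_⊎_; inj₁; inj₂)
open import Relation.Nullary using (¬_; Dec; yes; no; ¬?; contradiction)

-- Let u ≻ v satisfy α ∈ Cond φ. While α is among the remaining antecedents A,
-- smoothness for ⋁ A moves u to a ≻-maximal element of ‖⋁ A‖ that, by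
-- transitivity, is still in Bet v; so D(Bet v, A) is nonempty and MaxSeq
-- picks some z. Either z satisfies α, or α survives into the strictly smaller
-- list of antecedents that z does not satisfy.

module _ {Var : Set} (M : PrefModel Var) where
  open PrefModel M using (W)

  private
    _⊨ᴹ_ : W → Form Var → Set
    _⊨ᴹ_ = _⊨_ M

    _≻ᴹ_ : W → W → Set
    _≻ᴹ_ = _≻_ M

  ≻-trans : Transitive M → ∀ {a b c} → a ≻ᴹ b → b ≻ᴹ c → a ≻ᴹ c
  ≻-trans tr {a} {b} {c} (a⪰b , b⋡a) (b⪰c , c⋡b) =
    tr a b c a⪰b b⪰c , λ c⪰a → c⋡b (tr c a b c⪰a a⪰b)

  UpwardClosed : (W → Set) → Set
  UpwardClosed U = ∀ {u w} → u ≻ᴹ w → U w → U u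

  Bet-upwardClosed : Transitive M → ∀ v → UpwardClosed (Bet M v)
  Bet-upwardClosed tr v u≻w w≻v = ≻-trans tr u≻w w≻v

  Max-resp : {U U′ : W → Set} → (∀ {w} → U w → U′ w) → (∀ {w} → U′ w → U w) →
             ∀ {u} → Max M U u → Max M U′ u
  Max-resp U⊆U′ U′⊆U (Uu , u-max) =
    U⊆U′ Uu , λ (x , U′x , x≻u) → u-max (x , U′⊆U U′x , x≻u)

  _∨_ : Form Var → Form Var → Form Var
  a ∨ b = neg (and (neg a) (neg b))

  -- Over an arbitrary Var there is no falsum formula, so ⋁ is only defined on
  -- nonempty lists a ∷ A.
  ⋁ : Form Var → List (Form Var) → Form Var
  ⋁ a []      = a
  ⋁ a (b ∷ A) = a ∨ ⋁ b A

  BigOr⇒⊨⋁ : ∀ a A {w} → BigOr M (a ∷ A) w → w ⊨ᴹ ⋁ a A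
  BigOr⇒⊨⋁ a []      (_ , here refl , wα) = wα
  BigOr⇒⊨⋁ a (b ∷ A) (_ , here refl , wα) (w⊭a , _) = w⊭a wα
  BigOr⇒⊨⋁ a (b ∷ A) (α , there α∈ , wα) (_ , w⊭⋁) =
    w⊭⋁ (BigOr⇒⊨⋁ b A (α , α∈ , wα))

  module _ (lem : ExcludedMiddle 0ℓ) where

    ⊨∨⇒⊎ : ∀ {w} a b → w ⊨ᴹ (a ∨ b) → w ⊨ᴹ a ⊎ w ⊨ᴹ b
    ⊨∨⇒⊎ {w} a b w⊨a∨b with lem {w ⊨ᴹ a} | lem {w ⊨ᴹ b}
    ... | yes w⊨a | _       = inj₁ w⊨a
    ... | no _    | yes w⊨b = inj₂ w⊨b
    ... | no w⊭a  | no w⊭b  = contradiction (w⊭a , w⊭b) w⊨a∨b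

    ⊨⋁⇒BigOr : ∀ a A {w} → w ⊨ᴹ ⋁ a A → BigOr M (a ∷ A) w
    ⊨⋁⇒BigOr a []      wa = a , here refl , wa
    ⊨⋁⇒BigOr a (b ∷ A) w⊨⋁ with ⊨∨⇒⊎ a (⋁ b A) w⊨⋁
    ... | inj₁ wa  = a , here refl , wa
    ... | inj₂ w⊨⋁′ = map₂ (map₁ there) (⊨⋁⇒BigOr b A w⊨⋁′)

    smooth-BigOr : Smooth M → ∀ a A {w} → BigOr M (a ∷ A) w →
                   ∃ λ u → Max M (BigOr M (a ∷ A)) u × (u ≡ w ⊎ u ≻ᴹ w)
    smooth-BigOr smooth a A {w} wA =
      map₂ (map₁ (Max-resp (⊨⋁⇒BigOr a A) (BigOr⇒⊨⋁ a A)))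
           (smooth (⋁ a A) w (BigOr⇒⊨⋁ a A wA))

    module _ (smooth : Smooth M) (r : Rep M) {U : W → Set} (U-up : UpwardClosed U) where
      open Rep r

      D-nonempty : ∀ {a A α} → α ∈ a ∷ A → SatForm M U α → ∃ (D M U (a ∷ A))
      D-nonempty {a} {A} α∈ (w , Uw , wα) with smooth-BigOr smooth a A (_ , α∈ , wα)
      ... | u , u-max , inj₁ refl = u , Uw , u-max
      ... | u , u-max , inj₂ u≻w  = u , U-up u≻w Uw , u-max

      ⊭? : ∀ z α → Dec (¬ z ⊨ᴹ α)
      ⊭? z α = ¬? (lem {z ⊨ᴹ α})

      unsatisfiedBy : W → List (Form Var) → List (Form Var)
      unsatisfiedBy z = filter (⊭? z)

      unsatisfiedBy-shorter : ∀ {z A} → BigOr M A z → length (unsatisfiedBy z A) < length A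
      unsatisfiedBy-shorter {z} {A} (β , β∈ , zβ) =
        filter-notAll (⊭? z) A (Any.map (λ { refl z⊭β → z⊭β zβ }) β∈)

      maxSeqF-preserves-SatForm : ∀ n A {α} → length A ≤ n → α ∈ A →
        SatForm M U α → SatForm M (_∈ maxSeqF M lem r n U A) α
      maxSeqF-preserves-SatForm n       []      _           ()
      maxSeqF-preserves-SatForm zero    (a ∷ A) ()
      maxSeqF-preserves-SatForm (suc n) (a ∷ A) {α} (s≤s |A|≤n) α∈ sat
        with lem {∃ (D M U (a ∷ A))}
      ... | no ∄D = contradiction (D-nonempty α∈ sat) ∄D
      ... | yes ∃D with lem {rep (D M U (a ∷ A)) ⊨ᴹ α}
      ...   | yes zα = _ , here refl , zα
      ...   | no z⊭α = map₂ (map₁ there)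
        (maxSeqF-preserves-SatForm n (unsatisfiedBy z (a ∷ A)) |A′|≤n
          (∈-filter⁺ (⊭? z) α∈ z⊭α) sat)
        where
        z : W
        z = rep (D M U (a ∷ A))

        z∈⋁A : BigOr M (a ∷ A) z
        z∈⋁A = proj₁ (proj₂ (rep-mem _ ∃D))

        |A′|≤n : length (unsatisfiedBy z (a ∷ A)) ≤ n
        |A′|≤n = ≤-trans (≤-pred (unsatisfiedBy-shorter z∈⋁A)) |A|≤n

lemma3p19 : (lem : ExcludedMiddle 0ℓ) → {Var : Set} → (M : PrefModel Var) →
    Smooth M → Transitive M → (φ : Form Var) → (r : Rep M) →
    (v : PrefModel.W M) →
    IVCovers M φ (chain M (MaxSeq M lem r (Bet M v) (cond φ)))
      (antichain M (λ w → w ≡ v))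
lemma3p19 lem M smooth tr φ r v .v refl α α∈ sat =
  maxSeqF-preserves-SatForm M lem smooth r (Bet-upwardClosed M tr v)
    (length (cond φ)) (cond φ) ≤-refl α∈ sat
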